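{- Let $C'$ be a column of $c'$ distinct positive integers and $S$ a set of $c\in\{c',c'+1\}$ positive integers with $s_r\le e_r$ for all $r\le c'$ (where $s_1<\dots<s_c$ are the elements of $S$ and $e_1<\dots<e_{c'}$ the entries of $C'$ in increasing order), and let $\widehat{C}=\widehat{C}(S,C')$. Let $C$ be an ordering of $S$ such that $CC'$ is HHL. Suppose there are two pivot entries $x<y$ of $\widehat{C}C'$ such that the column $\widetilde{C}$ obtained from $C$ by swapping the positions of $x$ and $y$ makes $\widetilde{C}C'$ HHL. Then $\widehat{C}C'$ does not satisfy the Non-overlapping Condition.
   Context: Hat construction: $\widehat{C}$ is the column of length $c$ obtained by processing the elements of $S$ in decreasing order: an element $a$ occurring in $C'$ is placed in the row in which $a$ occurs in $C'$; an element not occurring in $C'$ is placed, if $c=c'+1$ and row $c'+1$ is still empty, in row $c'+1$, and otherwise in the row of the largest entry of $C'$ whose row in the left column is still empty. A two-column configuration $CC'$ (top-aligned, lengths $c\in\{c',c'+1\}$) is HHL if entries in each column are distinct, $C(r)\le C'(r)$ for $r\le c'$, and $C(r)\ne C'(s)$ whenever $s<r$. A row $q$ of $\widehat{C}C'$ is a pivot if $q\le c'$ and $\widehat{C}(q)<C'(q)$, or $q=c'+1\le c$; pivot entries are the values $\widehat{C}(q)$ at pivot rows. For a pivot row $q$ let $b_q=\widehat{C}(q)$ and $d_q=C'(q)$ if $q\le c'$, $d_q=\infty$ otherwise. $\widehat{C}C'$ satisfies the Non-overlapping Condition if it has at most one pivot row or the intervals $[b_q,d_q]$ for distinct pivot rows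 are pairwise disjoint. -}

module Defs where

open import Data.Nat using (ℕ; zero; suc; _<_; _≤_; _≟_)
open import Data.Nat.Properties using (≤-decTotalOrder)
open import Data.List using (List; []; _∷_; length; map; replicate; foldr)
open import Data.Maybe using (Maybe; just; nothing; fromMaybe)
open import Data.Bool using (Bool; true; false; if_then_else_)
open import Data.Product using (_×_; _,_; ∃; ∃-syntax)
open import Data.Sum using (_⊎_)
open import Data.Empty using (⊥)
open import Relation.Nullary using (does; ¬_)
open import Relation.Binary.PropositionalEquality using (_≡_; _≢_)
open import Data.List.Relation.Unary.Unique.Propositional using (Unique)
import Data.List.Sort as Sort

-- Columns are lists of natural numbers; row r (0-based here, i.e. row r+1
-- of the paper) of a column C is  C ‼ r .

_‼_ : {A : Set} → List A → ℕ → Maybe A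
[] ‼ _ = nothing
(x ∷ xs) ‼ zero = just x
(x ∷ xs) ‼ suc n = xs ‼ n

sortℕ : List ℕ → List ℕ
sortℕ = Sort.sort ≤-decTotalOrder

setAt : {A : Set} → List A → ℕ → A → List A
setAt [] _ _ = []
setAt (x ∷ xs) zero a = a ∷ xs
setAt (x ∷ xs) (suc n) a = x ∷ setAt xs n a

indexOf : ℕ → List ℕ → Maybe ℕ
indexOf a [] = nothing
indexOf a (x ∷ xs) with does (a ≟ x)
... | true = just zero
... | false with indexOf a xs
...   | just r = just (suc r)
...   | nothing = nothing

isEmptyRow : List (Maybe ℕ) → ℕ → Bool
isEmptyRow st r with st ‼ r
... | just nothing = true
... | _ = false

-- Among rows r of C' (C' given with its starting row offset k) whose row in
-- the partial left column st is still empty, the row of the largest entry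
-- of C'.  Returns (row , entry).
largestEmpty : List (Maybe ℕ) → ℕ → List ℕ → Maybe (ℕ × ℕ)
largestEmpty st k [] = nothing
largestEmpty st k (x ∷ xs) with largestEmpty st (suc k) xs | isEmptyRow st k
... | nothing | true = just (k , x)
... | nothing | false = nothing
... | just (r , y) | true = if does (Data.Nat._<?_ y x) then just (k , x) else just (r , y)
... | just (r , y) | false = just (r , y)

hatStep : ℕ → List ℕ → ℕ → List (Maybe ℕ) → List (Maybe ℕ)
hatStep c C' a st with indexOf a C'
... | just r = setAt st r (just a)
... | nothing with does (c ≟ suc (length C')) | isEmptyRow st (length C')
...   | true | true = setAt st (length C') (just a)
...   | _ | _ with largestEmpty st zero C'
...     | just (r , _) = setAt st r (just a)
...     | nothing = st

-- Ĉ(S, C'): S is given as its strictly increasing list of elements;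
-- foldr processes the elements of S in decreasing order.
-- (Rows left unfilled would get the dummy value 0; under the hypotheses of
-- the paper every row gets filled.)
hat : List ℕ → List ℕ → List ℕ
hat S C' = map (fromMaybe 0) (foldr (hatStep (length S) C') (replicate (length S) nothing) S)

HHL : List ℕ → List ℕ → Set
HHL C C' =
  (length C ≡ length C' ⊎ length C ≡ suc (length C')) ×
  Unique C × Unique C' ×
  (∀ r x y → C ‼ r ≡ just x → C' ‼ r ≡ just y → x ≤ y) ×
  (∀ r s x → s < r → C ‼ r ≡ just x → C' ‼ s ≡ just x → ⊥)

Pivot : List ℕ → List ℕ → ℕ → Set
Pivot L C' q =
  (∃[ b ] ∃[ d ] (L ‼ q ≡ just b × C' ‼ q ≡ just d × b < d)) ⊎
  (q ≡ length C' × length C' < length L)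

PivotEntry : List ℕ → List ℕ → ℕ → Set
PivotEntry L C' x = ∃[ q ] (Pivot L C' q × L ‼ q ≡ just x)

-- d_q : C'(q) if q is a row of C', ∞ (= nothing) otherwise
dval : List ℕ → ℕ → Maybe ℕ
dval C' q = C' ‼ q

-- d < b, where d = nothing means ∞ (never smaller)
LtB : Maybe ℕ → ℕ → Set
LtB (just d) b = d < b
LtB nothing b = ⊥

DisjointIntervals : ℕ → Maybe ℕ → ℕ → Maybe ℕ → Set
DisjointIntervals b d b' d' = LtB d b' ⊎ LtB d' b

NonOverlapping : List ℕ → List ℕ → Set
NonOverlapping L C' =
  (∀ q q' → Pivot L C' q → Pivot L C' q' → q ≡ q') ⊎
  (∀ q q' b b' → Pivot L C' q → Pivot L C' q' → q ≢ q' →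
     L ‼ q ≡ just b → L ‼ q' ≡ just b' →
     DisjointIntervals b (dval C' q) b' (dval C' q'))

swapVals : ℕ → ℕ → List ℕ → List ℕ
swapVals x y = map (λ z → if does (z ≟ x) then y else (if does (z ≟ y) then x else z))

{-# OPTIONS --safe #-}
-- Follow the construction of Ĉ: an element of C' lands in its own row; any other element w lands
-- in the extra row or in a row whose C'-entry exceeds w, and when such an x is put into row q, every
-- row whose C'-entry exceeds C'(q), as well as the extra row, already holds a larger element.  The
-- Hall-type condition s_r ≤ e_r guarantees that a suitable empty row always exists.
--
-- Suppose the pivot intervals of Ĉ were disjoint.  As x < y, the interval [x, d] of x ends below y,
-- so x ∉ C' and d = C'(q) < y.  Every row "above d" (C'-entry larger than d, or the extra row) holds
-- in Ĉ an entry larger than x, and even larger than d, since otherwise that row would be a pivot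
-- whose interval meets [x, d].  In C, an entry larger than d can only sit in a row above d (HHL), and
-- the row of x in C is above d because swapping in y keeps the configuration HHL.  Hence C has fewer
-- entries larger than d than Ĉ, although both are orderings of S.
module Submission where

open import Defs
open import Level using (Level)
open import Data.Nat using (ℕ; zero; suc; _<_; _≤_; _∸_; _+_; z≤n; s≤s; z<s; _<?_; _≟_)
open import Data.Nat.Properties
open import Data.List using (List; []; _∷_; length; map; replicate; foldr; filter; catMaybes)
open import Data.List.Properties
  using (length-replicate; length-catMaybes; filter-all; length-map; map-∘; map-id)
open import Data.List.Membership.Propositional using (_∈_; _∉_)
open import Data.List.Relation.Unary.All as All using (All; []; _∷_)
open import Data.List.Relation.Unary.Any using (here; there)
open import Data.List.Relation.Unary.Unique.Propositional using (Unique)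
open import Data.List.Relation.Unary.Linked as Linked using (Linked; []; [-]; _∷_)
open import Data.List.Relation.Unary.Linked.Properties using (Linked⇒All)
open import Data.List.Relation.Binary.Permutation.Propositional
  using (_↭_; prep; swap; ↭-refl; ↭-sym; ↭-trans)
open import Data.List.Relation.Binary.Permutation.Propositional.Properties
  using (∈-resp-↭; ↭-length; filter-↭)
import Data.List.Sort as Sort
open import Data.Maybe using (Maybe; just; nothing; fromMaybe; Is-just)
import Data.Maybe as Maybe
open import Data.Maybe.Properties using (just-injective; map-injective)
open import Data.Maybe.Relation.Unary.Any as MAny using (just)
open import Data.Product using (_×_; _,_; proj₁; proj₂; ∃-syntax)
open import Data.Sum using (_⊎_; inj₁; inj₂; [_,_]′)
open import Data.Unit using (tt)
open import Data.Bool using (true; false; if_then_else_)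
open import Data.Empty using (⊥; ⊥-elim)
open import Function using (_∘_)
open import Relation.Nullary using (¬_; Dec; yes; no; does; proof; ofʸ; ofⁿ; ¬?)
open import Relation.Nullary.Decidable using (dec-true; decidable-stable; _×-dec_; _⊎-dec_)
open import Relation.Unary using (Pred; Decidable)
open import Relation.Binary.PropositionalEquality
  using (_≡_; _≢_; refl; sym; trans; cong; subst; subst₂)

private variable
  ℓ : Level
  A B : Set
  P Q : Pred ℕ ℓ

‼-map : (f : A → B) (xs : List A) (r : ℕ) → map f xs ‼ r ≡ Maybe.map f (xs ‼ r)
‼-map f [] r = refl
‼-map f (x ∷ xs) zero = refl
‼-map f (x ∷ xs) (suc r) = ‼-map f xs r

‼-just⇒< : (xs : List A) (r : ℕ) {a : A} → xs ‼ r ≡ just a → r < length xs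
‼-just⇒< (x ∷ xs) zero _ = z<s
‼-just⇒< (x ∷ xs) (suc r) eq = s≤s (‼-just⇒< xs r eq)

‼-nothing⇒≥ : (xs : List A) (r : ℕ) → xs ‼ r ≡ nothing → length xs ≤ r
‼-nothing⇒≥ [] r _ = z≤n
‼-nothing⇒≥ (x ∷ xs) (suc r) eq = s≤s (‼-nothing⇒≥ xs r eq)

‼-length : (xs : List A) → xs ‼ length xs ≡ nothing
‼-length [] = refl
‼-length (x ∷ xs) = ‼-length xs

‼-<⇒just : (xs : List A) (r : ℕ) → r < length xs → ∃[ a ] (xs ‼ r ≡ just a)
‼-<⇒just (x ∷ xs) zero _ = x , refl
‼-<⇒just (x ∷ xs) (suc r) (s≤s r<n) = ‼-<⇒just xs r r<n

∈⇒‼ : {a : A} (xs : List A) → a ∈ xs → ∃[ r ] (xs ‼ r ≡ just a)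
∈⇒‼ (x ∷ xs) (here refl) = 0 , refl
∈⇒‼ (x ∷ xs) (there a∈xs) with r , eq ← ∈⇒‼ xs a∈xs = suc r , eq

‼⇒∈ : {a : A} (xs : List A) (r : ℕ) → xs ‼ r ≡ just a → a ∈ xs
‼⇒∈ (x ∷ xs) zero refl = here refl
‼⇒∈ (x ∷ xs) (suc r) eq = there (‼⇒∈ xs r eq)

‼-replicate : ∀ n {a b : A} r → replicate n a ‼ r ≡ just b → a ≡ b
‼-replicate (suc n) zero refl = refl
‼-replicate (suc n) (suc r) eq = ‼-replicate n r eq

length-setAt : (xs : List A) (r : ℕ) (v : A) → length (setAt xs r v) ≡ length xs
length-setAt [] r v = refl
length-setAt (x ∷ xs) zero v = refl
length-setAt (x ∷ xs) (suc r) v = cong suc (length-setAt xs r v)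

setAt-‼-≡ : (xs : List A) (r : ℕ) (v : A) → r < length xs → setAt xs r v ‼ r ≡ just v
setAt-‼-≡ (x ∷ xs) zero v _ = refl
setAt-‼-≡ (x ∷ xs) (suc r) v (s≤s r<n) = setAt-‼-≡ xs r v r<n

setAt-‼-≢ : (xs : List A) {r r' : ℕ} (v : A) → r ≢ r' → setAt xs r v ‼ r' ≡ xs ‼ r'
setAt-‼-≢ [] v _ = refl
setAt-‼-≢ (x ∷ xs) {zero} {zero} v r≢r' = ⊥-elim (r≢r' refl)
setAt-‼-≢ (x ∷ xs) {zero} {suc r'} v _ = refl
setAt-‼-≢ (x ∷ xs) {suc r} {zero} v _ = refl
setAt-‼-≢ (x ∷ xs) {suc r} {suc r'} v r≢r' = setAt-‼-≢ xs v (r≢r' ∘ cong suc)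

count : Decidable P → ℕ → ℕ
count P? zero = 0
count P? (suc n) with does (P? 0)
... | true = suc (count (P? ∘ suc) n)
... | false = count (P? ∘ suc) n

count-mono : (P? : Decidable P) (Q? : Decidable Q) (n : ℕ) →
  (∀ {i} → i < n → P i → Q i) → count P? n ≤ count Q? n
count-mono P? Q? zero _ = z≤n
count-mono P? Q? (suc n) P⇒Q with P? 0 | Q? 0 | count-mono (P? ∘ suc) (Q? ∘ suc) n (P⇒Q ∘ s≤s)
... | yes _ | yes _ | ih = s≤s ih
... | yes p | no ¬q | _ = ⊥-elim (¬q (P⇒Q z<s p))
... | no _ | yes _ | ih = m≤n⇒m≤1+n ih
... | no _ | no _ | ih = ih

count-strict : (P? : Decidable P) (Q? : Decidable Q) (n : ℕ) →
  (∀ {i} → i < n → P i → Q i) → ∀ {j} → j < n → Q j → ¬ P j → count P? n < count Q? n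
count-strict P? Q? (suc n) P⇒Q {zero} _ q ¬p with P? 0 | Q? 0
... | yes p | _ = ⊥-elim (¬p p)
... | no _ | yes _ = s≤s (count-mono (P? ∘ suc) (Q? ∘ suc) n (P⇒Q ∘ s≤s))
... | no _ | no ¬q = ⊥-elim (¬q q)
count-strict P? Q? (suc n) P⇒Q {suc j} (s≤s j<n) q ¬p
  with P? 0 | Q? 0 | count-strict (P? ∘ suc) (Q? ∘ suc) n (P⇒Q ∘ s≤s) j<n q ¬p
... | yes _ | yes _ | ih = s≤s ih
... | yes p | no ¬q | _ = ⊥-elim (¬q (P⇒Q z<s p))
... | no _ | yes _ | ih = m≤n⇒m≤1+n ih
... | no _ | no _ | ih = ih

count-pigeonhole : (P? : Decidable P) (Q? : Decidable Q) (n : ℕ) →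
  count Q? n < count P? n → ∃[ i ] (i < n × P i × ¬ Q i)
count-pigeonhole P? Q? n lt with anyUpTo? (λ i → P? i ×-dec ¬? (Q? i)) n
... | yes witness = witness
... | no none = ⊥-elim (<⇒≱ lt (count-mono P? Q? n
  λ {i} i<n p → decidable-stable (Q? i) (λ ¬q → none (i , i<n , p , ¬q))))

count-none : (P? : Decidable P) (n : ℕ) → (∀ i → ¬ P i) → count P? n ≡ 0
count-none P? zero _ = refl
count-none P? (suc n) ¬P with P? 0
... | yes p = ⊥-elim (¬P 0 p)
... | no _ = count-none (P? ∘ suc) n (¬P ∘ suc)

count-‼ : {P : Pred A ℓ} (P? : Decidable P) (xs : List A) (n : ℕ) → length xs ≤ n →
  count (λ i → MAny.dec P? (xs ‼ i)) n ≡ length (filter P? xs)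
count-‼ P? [] n _ = count-none _ n (λ _ ())
count-‼ P? (x ∷ xs) (suc n) (s≤s len≤n) with P? x
... | yes _ = cong suc (count-‼ P? xs n len≤n)
... | no _ = count-‼ P? xs n len≤n

any-just : {P : Pred A ℓ} {m : Maybe A} {a : A} → MAny.Any P m → m ≡ just a → P a
any-just (just p) refl = p

any-intro : {P : Pred A ℓ} {m : Maybe A} {a : A} → m ≡ just a → P a → MAny.Any P m
any-intro refl p = just p

any-elim : {P : Pred A ℓ} {m : Maybe A} → MAny.Any P m → ∃[ a ] (m ≡ just a × P a)
any-elim (just p) = _ , refl , p

Filled : List (Maybe A) → ℕ → Set
Filled st r = MAny.Any Is-just (st ‼ r)

filled? : (st : List (Maybe A)) → Decidable (Filled st)
filled? st r = MAny.dec (MAny.dec (λ _ → yes tt)) (st ‼ r)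

Empty : List (Maybe A) → ℕ → Set
Empty st r = st ‼ r ≡ just nothing

unfilled⇒Empty : (st : List (Maybe A)) (r : ℕ) → r < length st → ¬ Filled st r → Empty st r
unfilled⇒Empty st r r<n ¬filled with ‼-<⇒just st r r<n
... | nothing , eq = eq
... | just a , eq = ⊥-elim (¬filled (any-intro eq (just tt)))

setAt-keeps-filled : (st : List (Maybe A)) {r r' : ℕ} (v : Maybe A) {a : A} →
  Empty st r → st ‼ r' ≡ just (just a) → setAt st r v ‼ r' ≡ just (just a)
setAt-keeps-filled st {r} {r'} v empty filled with r ≟ r'
... | yes refl with () ← trans (sym empty) filled
... | no r≢r' = trans (setAt-‼-≢ st v r≢r') filled

catMaybes-setAt : (st : List (Maybe A)) (r : ℕ) (a : A) → Empty st r →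
  catMaybes (setAt st r (just a)) ↭ a ∷ catMaybes st
catMaybes-setAt (nothing ∷ st) zero a _ = ↭-refl
catMaybes-setAt (nothing ∷ st) (suc r) a empty = catMaybes-setAt st r a empty
catMaybes-setAt (just b ∷ st) (suc r) a empty =
  ↭-trans (prep b (catMaybes-setAt st r a empty)) (swap b a ↭-refl)

∈-catMaybes : (st : List (Maybe A)) (r : ℕ) {a : A} → st ‼ r ≡ just (just a) → a ∈ catMaybes st
∈-catMaybes (just b ∷ st) zero refl = here refl
∈-catMaybes (nothing ∷ st) (suc r) eq = ∈-catMaybes st r eq
∈-catMaybes (just b ∷ st) (suc r) eq = there (∈-catMaybes st r eq)

catMaybes-replicate : ∀ n → catMaybes (replicate n (nothing {A = A})) ≡ []
catMaybes-replicate zero = refl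
catMaybes-replicate (suc n) = catMaybes-replicate n

catMaybes-map-just : (xs : List A) → catMaybes (map just xs) ≡ xs
catMaybes-map-just [] = refl
catMaybes-map-just (x ∷ xs) = cong (x ∷_) (catMaybes-map-just xs)

count-filled : (st : List (Maybe A)) → count (filled? st) (length st) ≡ length (catMaybes st)
count-filled [] = refl
count-filled (just a ∷ st) = cong suc (count-filled st)
count-filled (nothing ∷ st) = count-filled st

catMaybes-complete : (st : List (Maybe A)) → length (catMaybes st) ≡ length st →
  st ≡ map just (catMaybes st)
catMaybes-complete [] _ = refl
catMaybes-complete (just a ∷ st) eq = cong (just a ∷_) (catMaybes-complete st (suc-injective eq))
catMaybes-complete (nothing ∷ st) eq = ⊥-elim (1+n≰n (subst (_≤ length st) eq (length-catMaybes st)))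

isEmptyRow⇒Empty : (st : List (Maybe ℕ)) (r : ℕ) → isEmptyRow st r ≡ true → Empty st r
isEmptyRow⇒Empty st r eq with st ‼ r
... | just nothing = refl
... | just (just _) with () ← eq
... | nothing with () ← eq

isEmptyRow-false : (st : List (Maybe ℕ)) (r : ℕ) → isEmptyRow st r ≡ false → ¬ Empty st r
isEmptyRow-false st r eq empty with st ‼ r
isEmptyRow-false st r () refl | just nothing

indexOf-just : ∀ a (xs : List ℕ) {r} → indexOf a xs ≡ just r → xs ‼ r ≡ just a
indexOf-just a (x ∷ xs) eq with does (a ≟ x) | proof (a ≟ x)
indexOf-just a (x ∷ xs) refl | true | ofʸ refl = refl
... | false | _ with indexOf a xs in found
indexOf-just a (x ∷ xs) refl | false | _ | just r = indexOf-just a xs found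

indexOf-nothing : ∀ a (xs : List ℕ) → indexOf a xs ≡ nothing → a ∉ xs
indexOf-nothing a (x ∷ xs) eq a∈ with does (a ≟ x) | proof (a ≟ x)
indexOf-nothing a (x ∷ xs) () a∈ | true | _
... | false | ofⁿ a≢x with indexOf a xs in found
indexOf-nothing a (x ∷ xs) () a∈ | false | _ | just _
indexOf-nothing a (x ∷ xs) refl (here a≡x) | false | ofⁿ a≢x | nothing = a≢x a≡x
indexOf-nothing a (x ∷ xs) refl (there a∈xs) | false | _ | nothing = indexOf-nothing a xs found a∈xs

-- row j of L is row k + j of st
LargestEmptyRow : List (Maybe ℕ) → ℕ → List ℕ → Maybe (ℕ × ℕ) → Set
LargestEmptyRow st k L nothing = ∀ {j e} → L ‼ j ≡ just e → ¬ Empty st (k + j)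
LargestEmptyRow st k L (just (r , e)) =
  (∃[ j ] (r ≡ k + j × L ‼ j ≡ just e)) × Empty st r ×
  (∀ {j e'} → L ‼ j ≡ just e' → Empty st (k + j) → e' ≤ e)

private
  row-here : ∀ k {x : ℕ} {L} → ∃[ j ] (k ≡ k + j × (x ∷ L) ‼ j ≡ just x)
  row-here k = 0 , sym (+-identityʳ k) , refl

  row-there : ∀ k {x r e : ℕ} {L} → ∃[ j ] (r ≡ suc k + j × L ‼ j ≡ just e) →
    ∃[ j ] (r ≡ k + j × (x ∷ L) ‼ j ≡ just e)
  row-there k (j , r≡ , eq) = suc j , trans r≡ (sym (+-suc k j)) , eq

  shift : (st : List (Maybe ℕ)) (k j : ℕ) → Empty st (k + suc j) → Empty st (suc k + j)
  shift st k j = subst (Empty st) (+-suc k j)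

largestEmpty-correct : ∀ st k L → LargestEmptyRow st k L (largestEmpty st k L)
largestEmpty-correct st k [] = λ ()
largestEmpty-correct st k (x ∷ xs)
  with largestEmpty st (suc k) xs | largestEmpty-correct st (suc k) xs | isEmptyRow st k in emptyₖ
... | nothing | none | true = row-here k , isEmptyRow⇒Empty st k emptyₖ , max
  where
    max : ∀ {j e'} → (x ∷ xs) ‼ j ≡ just e' → Empty st (k + j) → e' ≤ x
    max {zero} refl _ = ≤-refl
    max {suc j} xsⱼ empty = ⊥-elim (none xsⱼ (shift st k j empty))
... | nothing | none | false = none′
  where
    none′ : ∀ {j e} → (x ∷ xs) ‼ j ≡ just e → ¬ Empty st (k + j)
    none′ {zero} _ empty = isEmptyRow-false st k emptyₖ (subst (Empty st) (+-identityʳ k) empty)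
    none′ {suc j} xsⱼ empty = none xsⱼ (shift st k j empty)
... | just (r , y) | (at , empty , max) | true with does (y <? x) | proof (y <? x)
...   | true | ofʸ y<x = row-here k , isEmptyRow⇒Empty st k emptyₖ , max′
  where
    max′ : ∀ {j e'} → (x ∷ xs) ‼ j ≡ just e' → Empty st (k + j) → e' ≤ x
    max′ {zero} refl _ = ≤-refl
    max′ {suc j} xsⱼ emptyⱼ = ≤-trans (max xsⱼ (shift st k j emptyⱼ)) (<⇒≤ y<x)
...   | false | ofⁿ y≮x = row-there k at , empty , max′
  where
    max′ : ∀ {j e'} → (x ∷ xs) ‼ j ≡ just e' → Empty st (k + j) → e' ≤ y
    max′ {zero} refl _ = ≮⇒≥ y≮x
    max′ {suc j} xsⱼ emptyⱼ = max xsⱼ (shift st k j emptyⱼ)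
largestEmpty-correct st k (x ∷ xs) | just (r , y) | (at , empty , max) | false =
  row-there k at , empty , max′
  where
    max′ : ∀ {j e'} → (x ∷ xs) ‼ j ≡ just e' → Empty st (k + j) → e' ≤ y
    max′ {zero} _ empty₀ =
      ⊥-elim (isEmptyRow-false st k emptyₖ (subst (Empty st) (+-identityʳ k) empty₀))
    max′ {suc j} xsⱼ emptyⱼ = max xsⱼ (shift st k j emptyⱼ)

linked-head-below : {a : ℕ} {as : List ℕ} → Linked _<_ (a ∷ as) → All (a <_) as
linked-head-below [-] = []
linked-head-below (a<b ∷ sorted) = Linked⇒All <-trans a<b sorted

length-filter-sorted : {a e : ℕ} (xs : List ℕ) (k : ℕ) → Linked _≤_ xs → xs ‼ k ≡ just e → a < e →
  length xs ∸ k ≤ length (filter (a <?_) xs)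
length-filter-sorted {a} (x ∷ xs) zero sorted refl a<x =
  ≤-reflexive (sym (cong length (filter-all (a <?_) x∷xs-above)))
  where
    x∷xs-above = All.map (<-≤-trans a<x) (Linked⇒All ≤-trans ≤-refl sorted)
length-filter-sorted {a} (x ∷ xs) (suc k) sorted xsₖ a<e with does (a <? x)
... | true = m≤n⇒m≤1+n (length-filter-sorted xs k (Linked.tail sorted) xsₖ a<e)
... | false = length-filter-sorted xs k (Linked.tail sorted) xsₖ a<e

m∸o≤[n∸o]+[m∸n] : ∀ m n o → m ∸ o ≤ (n ∸ o) + (m ∸ n)
m∸o≤[n∸o]+[m∸n] m n zero = m≤n+m∸n m n
m∸o≤[n∸o]+[m∸n] zero n (suc o) = z≤n
m∸o≤[n∸o]+[m∸n] (suc m) zero (suc o) = m≤n⇒m≤1+n (m∸n≤m m o)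
m∸o≤[n∸o]+[m∸n] (suc m) (suc n) (suc o) = m∸o≤[n∸o]+[m∸n] m n o

LtB⇒just : ∀ m {b} → LtB m b → ∃[ d ] (m ≡ just d × d < b)
LtB⇒just (just d) d<b = d , refl , d<b

LtB-mono : ∀ m {b b'} → b ≤ b' → LtB m b → LtB m b'
LtB-mono (just d) b≤b' d<b = <-≤-trans d<b b≤b'

pivot-< : ∀ L C' {q b d} → Pivot L C' q → L ‼ q ≡ just b → C' ‼ q ≡ just d → b < d
pivot-< L C' (inj₁ (_ , _ , Lq , C'q , b<d)) Lq′ C'q′ =
  subst₂ _<_ (just-injective (trans (sym Lq) Lq′)) (just-injective (trans (sym C'q) C'q′)) b<d
pivot-< L C' (inj₂ (refl , _)) _ C'q with () ← trans (sym (‼-length C')) C'q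

pivot-¬LtB : ∀ L C' {q b} → Pivot L C' q → L ‼ q ≡ just b → ¬ LtB (C' ‼ q) b
pivot-¬LtB L C' {q} pivot Lq below with d , C'q , d<b ← LtB⇒just (C' ‼ q) below =
  <-asym (pivot-< L C' pivot Lq C'q) d<b

distinct-rows : ∀ (L : List ℕ) {q q' x y} → L ‼ q ≡ just x → L ‼ q' ≡ just y → x < y → q ≢ q'
distinct-rows L Lq Lq' x<y refl = <-irrefl (just-injective (trans (sym Lq) Lq')) x<y

swapVals-‼ : ∀ {x y r} (C : List ℕ) → C ‼ r ≡ just x → swapVals x y C ‼ r ≡ just y
swapVals-‼ {x} {y} {r} C Cᵣ =
  trans (‼-map _ C r) (trans (cong (Maybe.map _) Cᵣ)
    (cong (λ b → just (if b then y else (if does (x ≟ y) then x else x))) (dec-true (x ≟ x) refl)))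

RowwiseBelow : List ℕ → List ℕ → Set
RowwiseBelow C C' = ∀ r x y → C ‼ r ≡ just x → C' ‼ r ≡ just y → x ≤ y

HHL⇒RowwiseBelow : ∀ {C C'} → HHL C C' → RowwiseBelow C C'
HHL⇒RowwiseBelow (_ , _ , _ , below , _) = below

-- c is the length of S; row length C' is the extra row, present when c = length C' + 1
module HatConstruction (C' : List ℕ) (c : ℕ) (c≡ : c ≡ length C' ⊎ c ≡ suc (length C')) where

  ExtraRow : ℕ → Set
  ExtraRow r = r ≡ length C' × c ≡ suc (length C')

  RowAbove : ℕ → ℕ → Set
  RowAbove e r = MAny.Any (e <_) (C' ‼ r) ⊎ ExtraRow r

  rowAbove? : ∀ e → Decidable (RowAbove e)
  rowAbove? e r = MAny.dec (e <?_) (C' ‼ r) ⊎-dec ((r ≟ length C') ×-dec (c ≟ suc (length C')))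

  Placed : ℕ → ℕ → Set
  Placed r w = C' ‼ r ≡ just w ⊎ (w ∉ C' × RowAbove w r)

  length-C'≤c : length C' ≤ c
  length-C'≤c = [ ≤-reflexive ∘ sym , (λ c≡1+ → subst (length C' ≤_) (sym c≡1+) (n≤1+n _)) ]′ c≡

  c≤1+length-C' : c ≤ suc (length C')
  c≤1+length-C' = [ (λ c≡0+ → subst (_≤ suc (length C')) (sym c≡0+) (n≤1+n _)) , ≤-reflexive ]′ c≡

  row<c : ∀ {r e} → C' ‼ r ≡ just e → r < c
  row<c {r} C'ᵣ = <-≤-trans (‼-just⇒< C' r C'ᵣ) length-C'≤c

  extraRow<c : ∀ {r} → ExtraRow r → r < c
  extraRow<c (refl , c≡1+) = ≤-reflexive (sym c≡1+)

  extraRow-outside : ∀ {r e} → ExtraRow r → C' ‼ r ≢ just e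
  extraRow-outside (refl , _) C'ᵣ with () ← trans (sym (‼-length C')) C'ᵣ

  rowAbove-just : ∀ {e r e'} → RowAbove e r → C' ‼ r ≡ just e' → e < e'
  rowAbove-just (inj₁ above) C'ᵣ = any-just above C'ᵣ
  rowAbove-just (inj₂ extra) C'ᵣ = ⊥-elim (extraRow-outside extra C'ᵣ)

  outside-C'⇒extraRow : ∀ {r} → r < c → C' ‼ r ≡ nothing → ExtraRow r
  outside-C'⇒extraRow {r} r<c C'ᵣ = r≡ , ≤-antisym c≤1+length-C' (subst (_< c) r≡ r<c)
    where
      r≡ : r ≡ length C'
      r≡ = ≤-antisym (≤-pred (≤-trans r<c c≤1+length-C')) (‼-nothing⇒≥ C' r C'ᵣ)

  Guards : List (Maybe ℕ) → ℕ → ℕ → Set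
  Guards st q x = ∀ {e r} → x ∉ C' → C' ‼ q ≡ just e → RowAbove e r →
    ∃[ w ] (st ‼ r ≡ just (just w) × x < w)

  guards-setAt : ∀ st r {q x} (v : Maybe ℕ) → Empty st r → Guards st q x → Guards (setAt st r v) q x
  guards-setAt st r v empty guards x∉C' C'q above with w , filled , x<w ← guards x∉C' C'q above =
    w , setAt-keeps-filled st v empty filled , x<w

  NoEmptyExtraRow : List (Maybe ℕ) → Set
  NoEmptyExtraRow st = ∀ {r} → ExtraRow r → ¬ Empty st r

  data HatStep (a : ℕ) (st : List (Maybe ℕ)) : List (Maybe ℕ) → Set where
    own-row : ∀ {r} → C' ‼ r ≡ just a → HatStep a st (setAt st r (just a))
    extra-row : a ∉ C' → ExtraRow (length C') → Empty st (length C') →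
      HatStep a st (setAt st (length C') (just a))
    largest-empty-row : ∀ {r e} → a ∉ C' → NoEmptyExtraRow st → LargestEmptyRow st 0 C' (just (r , e)) →
      HatStep a st (setAt st r (just a))
    no-empty-row : a ∉ C' → NoEmptyExtraRow st → LargestEmptyRow st 0 C' nothing → HatStep a st st

  extraRow-filled : ∀ st → isEmptyRow st (length C') ≡ false → NoEmptyExtraRow st
  extraRow-filled st filled (refl , _) = isEmptyRow-false st _ filled

  no-extraRow : ∀ st → c ≢ suc (length C') → NoEmptyExtraRow st
  no-extraRow _ c≢1+ (_ , c≡1+) _ = c≢1+ c≡1+

  hatStep-view : ∀ a st → HatStep a st (hatStep c C' a st)
  hatStep-view a st with indexOf a C' in found
  ... | just r = own-row (indexOf-just a C' found)
  ... | nothing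
    with does (c ≟ suc (length C')) | proof (c ≟ suc (length C')) | isEmptyRow st (length C') in emptyExtra
  ...   | true | ofʸ c≡1+ | true =
    extra-row (indexOf-nothing a C' found) (refl , c≡1+) (isEmptyRow⇒Empty st _ emptyExtra)
  ...   | true | _ | false with largestEmpty st 0 C' | largestEmpty-correct st 0 C'
  ...     | just _ | spec = largest-empty-row (indexOf-nothing a C' found) (extraRow-filled st emptyExtra) spec
  ...     | nothing | spec = no-empty-row (indexOf-nothing a C' found) (extraRow-filled st emptyExtra) spec
  hatStep-view a st | nothing | false | ofⁿ c≢1+ | _ with largestEmpty st 0 C' | largestEmpty-correct st 0 C'
  ... | just _ | spec = largest-empty-row (indexOf-nothing a C' found) (no-extraRow st c≢1+) spec
  ... | nothing | spec = no-empty-row (indexOf-nothing a C' found) (no-extraRow st c≢1+) spec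

  record HatInvariant (as : List ℕ) (st : List (Maybe ℕ)) : Set where
    field
      length≡ : length st ≡ c
      entries : catMaybes st ↭ as
      placed : ∀ {r w} → st ‼ r ≡ just (just w) → Placed r w
      guarded : ∀ {q x} → st ‼ q ≡ just (just x) → Guards st q x

  module _ {as st} (I : HatInvariant as st) where
    open HatInvariant I

    filled-entry : ∀ {r w} → st ‼ r ≡ just (just w) → w ∈ as
    filled-entry {r} filled = ∈-resp-↭ entries (∈-catMaybes st r filled)

    nonempty-row : ∀ {a r} → All (a <_) as → r < c → ¬ Empty st r →
      ∃[ w ] (st ‼ r ≡ just (just w) × a < w)
    nonempty-row {r = r} a<as r<c ¬empty with ‼-<⇒just st r (subst (r <_) (sym length≡) r<c)
    ... | nothing , empty = ⊥-elim (¬empty empty)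
    ... | just w , filled = w , filled , All.lookup a<as (filled-entry filled)

    own-row-empty : ∀ {a r} → All (a <_) as → C' ‼ r ≡ just a → Empty st r
    own-row-empty {a} {r} a<as C'ᵣ with ‼-<⇒just st r (subst (r <_) (sym length≡) (row<c C'ᵣ))
    ... | nothing , empty = empty
    ... | just w , filled with All.lookup a<as (filled-entry filled) | placed filled
    ...   | a<w | inj₁ C'ᵣ≡w = ⊥-elim (<-irrefl (just-injective (trans (sym C'ᵣ) C'ᵣ≡w)) a<w)
    ...   | a<w | inj₂ (_ , w-above) = ⊥-elim (<-asym a<w (rowAbove-just w-above C'ᵣ))

    place : ∀ {a r} → Empty st r → Placed r a → Guards st r a →
      HatInvariant (a ∷ as) (setAt st r (just a))
    place {a} {r} empty placedₐ guardsₐ = record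
      { length≡ = trans (length-setAt st r (just a)) length≡
      ; entries = ↭-trans (catMaybes-setAt st r a empty) (prep a entries)
      ; placed = placed′
      ; guarded = guarded′
      }
      where
        new : setAt st r (just a) ‼ r ≡ just (just a)
        new = setAt-‼-≡ st r (just a) (‼-just⇒< st r empty)

        placed′ : ∀ {r' w} → setAt st r (just a) ‼ r' ≡ just (just w) → Placed r' w
        placed′ {r'} filled with r ≟ r'
        ... | yes refl with refl ← trans (sym new) filled = placedₐ
        ... | no r≢r' = placed (trans (sym (setAt-‼-≢ st (just a) r≢r')) filled)

        guarded′ : ∀ {q x} → setAt st r (just a) ‼ q ≡ just (just x) → Guards (setAt st r (just a)) q x
        guarded′ {q} filled with r ≟ q
        ... | yes refl with refl ← trans (sym new) filled = guards-setAt st r (just a) empty guardsₐ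
        ... | no r≢q =
          guards-setAt st r (just a) empty (guarded (trans (sym (setAt-‼-≢ st (just a) r≢q)) filled))

    filled-rows : count (filled? st) c ≡ length as
    filled-rows = trans (cong (count (filled? st)) (sym length≡)) (trans (count-filled st) (↭-length entries))

    empty-row-above : ∀ {a} → length as < count (rowAbove? a) c → NoEmptyExtraRow st →
      ∃[ r ] ∃[ e ] (C' ‼ r ≡ just e × a < e × Empty st r)
    empty-row-above {a} hall noExtra
      with i , i<c , above , ¬filled ←
             count-pigeonhole (rowAbove? a) (filled? st) c (subst (_< _) (sym filled-rows) hall)
      with empty ← unfilled⇒Empty st i (subst (i <_) (sym length≡) i<c) ¬filled | above
    ... | inj₂ extra = ⊥-elim (noExtra extra empty)
    ... | inj₁ aboveC' with e , C'ᵢ , a<e ← any-elim aboveC' = i , e , C'ᵢ , a<e , empty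

    place-largest-empty : ∀ {a r e} → All (a <_) as → a ∉ C' → length as < count (rowAbove? a) c →
      NoEmptyExtraRow st → LargestEmptyRow st 0 C' (just (r , e)) →
      HatInvariant (a ∷ as) (setAt st r (just a))
    place-largest-empty {a} {r} {e} a<as a∉C' hall noExtra ((j , refl , C'ⱼ) , empty , max)
      with r₀ , e₀ , C'ᵣ₀ , a<e₀ , emptyᵣ₀ ← empty-row-above hall noExtra =
      place empty (inj₂ (a∉C' , inj₁ (any-intro C'ⱼ (<-≤-trans a<e₀ (max C'ᵣ₀ emptyᵣ₀))))) guards
      where
        guards : Guards st j a
        guards _ C'ⱼ′ (inj₁ above) with e' , C'ᵣ' , e<e' ← any-elim above
          rewrite just-injective (trans (sym C'ⱼ) C'ⱼ′) =
          nonempty-row a<as (row<c C'ᵣ') (λ emptyᵣ' → <⇒≱ e<e' (max C'ᵣ' emptyᵣ'))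
        guards _ _ (inj₂ extra) = nonempty-row a<as (extraRow<c extra) (noExtra extra)

    no-largest-empty : ∀ {a} → length as < count (rowAbove? a) c → NoEmptyExtraRow st →
      ¬ LargestEmptyRow st 0 C' nothing
    no-largest-empty hall noExtra none with r₀ , e₀ , C'ᵣ₀ , _ , emptyᵣ₀ ← empty-row-above hall noExtra =
      none C'ᵣ₀ emptyᵣ₀

    hatStep-preserves : ∀ {a} → All (a <_) as → (a ∉ C' → length as < count (rowAbove? a) c) →
      HatInvariant (a ∷ as) (hatStep c C' a st)
    hatStep-preserves {a} a<as hall with hatStep c C' a st | hatStep-view a st
    ... | _ | own-row {r} C'ᵣ =
      place (own-row-empty a<as C'ᵣ) (inj₁ C'ᵣ) (λ a∉C' _ _ → ⊥-elim (a∉C' (‼⇒∈ C' r C'ᵣ)))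
    ... | _ | extra-row a∉C' extra empty = place empty (inj₂ (a∉C' , inj₂ extra))
      (λ _ C'ₑ _ → ⊥-elim (extraRow-outside extra C'ₑ))
    ... | _ | largest-empty-row a∉C' noExtra spec = place-largest-empty a<as a∉C' (hall a∉C') noExtra spec
    ... | _ | no-empty-row a∉C' noExtra spec = ⊥-elim (no-largest-empty (hall a∉C') noExtra spec)

  -- the condition s_r ≤ e_r, counted: for the k-th element a ∉ C' of T, the rows of C' above a
  -- and the extra row are at least as many as the elements of T from position k on
  HallCondition : List ℕ → Set
  HallCondition T = ∀ {k a} → T ‼ k ≡ just a → a ∉ C' → length T ∸ k ≤ count (rowAbove? a) c

  hatState-invariant : ∀ T → Linked _<_ T → HallCondition T →
    HatInvariant T (foldr (hatStep c C') (replicate c nothing) T)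
  hatState-invariant [] _ _ = record
    { length≡ = length-replicate c
    ; entries = subst (_↭ []) (sym (catMaybes-replicate c)) ↭-refl
    ; placed = λ {r} filled → ⊥-elim (nothing≢just (‼-replicate c r filled))
    ; guarded = λ {q} filled → ⊥-elim (nothing≢just (‼-replicate c q filled))
    }
    where
      nothing≢just : ∀ {w : ℕ} → nothing ≢ just w
      nothing≢just ()
  hatState-invariant (a ∷ as) sorted hall =
    hatStep-preserves (hatState-invariant as (Linked.tail sorted) (λ {k} → hall {suc k}))
      (linked-head-below sorted) (hall {0} refl)

  count-rowAbove : ∀ a → length (filter (a <?_) C') + (c ∸ length C') ≤ count (rowAbove? a) c
  count-rowAbove a = [ without-extra , with-extra ]′ c≡
    where
      open ≤-Reasoning
      n = length (filter (a <?_) C')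

      aboveC'? : Decidable (λ r → MAny.Any (a <_) (C' ‼ r))
      aboveC'? r = MAny.dec (a <?_) (C' ‼ r)

      count-aboveC' : count aboveC'? c ≡ n
      count-aboveC' = count-‼ (a <?_) C' c length-C'≤c

      without-extra : c ≡ length C' → n + (c ∸ length C') ≤ count (rowAbove? a) c
      without-extra c≡0+ = begin
        n + (c ∸ length C')  ≡⟨ cong (λ m → n + (m ∸ length C')) c≡0+ ⟩
        n + (length C' ∸ length C')  ≡⟨ cong (n +_) (n∸n≡0 (length C')) ⟩
        n + 0  ≡⟨ trans (+-identityʳ n) (sym count-aboveC') ⟩
        count aboveC'? c  ≤⟨ count-mono aboveC'? (rowAbove? a) c (λ _ → inj₁) ⟩
        count (rowAbove? a) c  ∎

      with-extra : c ≡ suc (length C') → n + (c ∸ length C') ≤ count (rowAbove? a) c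
      with-extra c≡1+ = begin
        n + (c ∸ length C')  ≡⟨ cong (λ m → n + (m ∸ length C')) c≡1+ ⟩
        n + (suc (length C') ∸ length C')  ≡⟨ cong (n +_) (m+n∸n≡m 1 (length C')) ⟩
        n + 1  ≡⟨ trans (+-comm n 1) (cong suc (sym count-aboveC')) ⟩
        suc (count aboveC'? c)  ≤⟨ count-strict aboveC'? (rowAbove? a) c (λ _ → inj₁)
                                     (extraRow<c extra) (inj₂ extra) (λ above → extraRow-outside extra
                                       (proj₁ (proj₂ (any-elim above)))) ⟩
        count (rowAbove? a) c  ∎
        where
          extra : ExtraRow (length C')
          extra = refl , c≡1+

  sorted-hall : (S : List ℕ) → length S ≡ c →
    (∀ r s e → r < length C' → S ‼ r ≡ just s → sortℕ C' ‼ r ≡ just e → s ≤ e) → HallCondition S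
  sorted-hall S length-S bounded {k} {a} Sₖ a∉C' = begin
    length S ∸ k  ≡⟨ cong (_∸ k) length-S ⟩
    c ∸ k  ≤⟨ m∸o≤[n∸o]+[m∸n] c (length C') k ⟩
    (length C' ∸ k) + (c ∸ length C')  ≤⟨ +-monoˡ-≤ (c ∸ length C') (entries-above (k <? length C')) ⟩
    length (filter (a <?_) C') + (c ∸ length C')  ≤⟨ count-rowAbove a ⟩
    count (rowAbove? a) c  ∎
    where
      open ≤-Reasoning
      sort↭ : sortℕ C' ↭ C'
      sort↭ = Sort.sort-↭ ≤-decTotalOrder C'

      entries-above : Dec (k < length C') → length C' ∸ k ≤ length (filter (a <?_) C')
      entries-above (no k≮c') =
        subst (_≤ length (filter (a <?_) C')) (sym (m≤n⇒m∸n≡0 (≮⇒≥ k≮c'))) z≤n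
      entries-above (yes k<c')
        with e , sortedₖ ← ‼-<⇒just (sortℕ C') k (subst (k <_) (sym (↭-length sort↭)) k<c') =
        subst₂ _≤_ (cong (_∸ k) (↭-length sort↭)) (↭-length (filter-↭ (a <?_) sort↭))
          (length-filter-sorted (sortℕ C') k (Sort.sort-↗ ≤-decTotalOrder C') sortedₖ a<e)
        where
          a<e : a < e
          a<e = ≤∧≢⇒< (bounded k a e k<c' Sₖ sortedₖ)
            (λ { refl → a∉C' (∈-resp-↭ sort↭ (‼⇒∈ (sortℕ C') k sortedₖ)) })

  record IsHatColumn (S H : List ℕ) : Set where
    field
      entries : H ↭ S
      placed : ∀ {r w} → H ‼ r ≡ just w → Placed r w
      guarded : ∀ {q x e r} → H ‼ q ≡ just x → x ∉ C' → C' ‼ q ≡ just e → RowAbove e r →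
                ∃[ w ] (H ‼ r ≡ just w × x < w)

  invariant⇒isHatColumn : ∀ {S} H → HatInvariant S (map just H) → IsHatColumn S H
  invariant⇒isHatColumn {S} H I = record
    { entries = subst (_↭ S) (catMaybes-map-just H) entries
    ; placed = placed ∘ lift
    ; guarded = λ Hq x∉C' C'q above →
        let w , Hᵣ , x<w = guarded (lift Hq) x∉C' C'q above in w , unlift Hᵣ , x<w
    }
    where
      open HatInvariant I
      lift : ∀ {r w} → H ‼ r ≡ just w → map just H ‼ r ≡ just (just w)
      lift {r} Hᵣ = trans (‼-map just H r) (cong (Maybe.map just) Hᵣ)
      unlift : ∀ {r w} → map just H ‼ r ≡ just (just w) → H ‼ r ≡ just w
      unlift {r} Hᵣ = map-injective just-injective (trans (sym (‼-map just H r)) Hᵣ)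

  rowAbove⇒pivot : ∀ H {r w} → length H ≡ c → H ‼ r ≡ just w → RowAbove w r → Pivot H C' r
  rowAbove⇒pivot H _ Hᵣ (inj₁ above) with e , C'ᵣ , w<e ← any-elim above = inj₁ (_ , e , Hᵣ , C'ᵣ , w<e)
  rowAbove⇒pivot H length-H _ (inj₂ (refl , c≡1+)) =
    inj₂ (refl , subst (length C' <_) (sym (trans length-H c≡1+)) ≤-refl)

  rowwiseBelow⇒rowAbove : ∀ L {i z d} → RowwiseBelow L C' → length L ≡ c →
    L ‼ i ≡ just z → d < z → RowAbove d i
  rowwiseBelow⇒rowAbove L {i} below length-L Lᵢ d<z with C' ‼ i in C'ᵢ
  ... | just e = inj₁ (just (<-≤-trans d<z (below i _ e Lᵢ C'ᵢ)))
  ... | nothing = inj₂ (outside-C'⇒extraRow (subst (i <_) length-L (‼-just⇒< L i Lᵢ)) C'ᵢ)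

  -- the entry w of a row above d exceeds x; if w < d, its row would be a pivot meeting [x, d]
  rows-above-filled : ∀ {S H q x d} → IsHatColumn S H → length H ≡ c →
    H ‼ q ≡ just x → x ∉ C' → C' ‼ q ≡ just d →
    (∀ {r w} → Pivot H C' r → q ≢ r → H ‼ r ≡ just w → DisjointIntervals x (just d) w (C' ‼ r)) →
    ∀ {r} → RowAbove d r → ∃[ w ] (H ‼ r ≡ just w × d < w)
  rows-above-filled {H = H} col length-H Hq x∉C' C'q disjoint {r} above
    with w , Hᵣ , x<w ← IsHatColumn.guarded col Hq x∉C' C'q above
    with IsHatColumn.placed col Hᵣ
  ... | inj₁ C'ᵣ = w , Hᵣ , rowAbove-just above C'ᵣ
  ... | inj₂ (_ , w-above) with pivotᵣ ← rowAbove⇒pivot H length-H Hᵣ w-above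
    with disjoint pivotᵣ (distinct-rows H Hq Hᵣ x<w) Hᵣ
  ...   | inj₁ d<w = w , Hᵣ , d<w
  ...   | inj₂ C'ᵣ<x = ⊥-elim (pivot-¬LtB H C' pivotᵣ Hᵣ (LtB-mono (C' ‼ r) (<⇒≤ x<w) C'ᵣ<x))

  no-room-above : ∀ {C H d rx x} → C ↭ H → length C ≡ c → length H ≡ c →
    (∀ {i z} → C ‼ i ≡ just z → d < z → RowAbove d i) →
    (∀ {r} → RowAbove d r → ∃[ w ] (H ‼ r ≡ just w × d < w)) →
    C ‼ rx ≡ just x → x ≤ d → RowAbove d rx → ⊥
  no-room-above {C} {H} {d} {rx} C↭H length-C length-H C-above H-above Cᵣₓ x≤d rx-above =
    <-irrefl same-count (begin-strict
      count (above? C) c      <⟨ count-strict (above? C) (rowAbove? d) c C⇒rowAbove rx<c rx-above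
                                   (λ x-above → <⇒≱ (any-just x-above Cᵣₓ) x≤d) ⟩
      count (rowAbove? d) c   ≤⟨ count-mono (rowAbove? d) (above? H) c rowAbove⇒H ⟩
      count (above? H) c      ∎)
    where
      open ≤-Reasoning
      above? : (L : List ℕ) → Decidable (λ i → MAny.Any (d <_) (L ‼ i))
      above? L i = MAny.dec (d <?_) (L ‼ i)

      same-count : count (above? C) c ≡ count (above? H) c
      same-count = trans (count-‼ (d <?_) C c (≤-reflexive length-C))
        (trans (↭-length (filter-↭ (d <?_) C↭H)) (sym (count-‼ (d <?_) H c (≤-reflexive length-H))))

      rx<c : rx < c
      rx<c = subst (rx <_) length-C (‼-just⇒< C rx Cᵣₓ)

      C⇒rowAbove : ∀ {i} → i < c → MAny.Any (d <_) (C ‼ i) → RowAbove d i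
      C⇒rowAbove _ entry-above with z , Cᵢ , d<z ← any-elim entry-above = C-above Cᵢ d<z

      rowAbove⇒H : ∀ {i} → i < c → RowAbove d i → MAny.Any (d <_) (H ‼ i)
      rowAbove⇒H _ i-above with w , Hᵢ , d<w ← H-above i-above = any-intro Hᵢ d<w

  isHatColumn-overlaps : ∀ {S H C} → IsHatColumn S H → length S ≡ c → C ↭ S → RowwiseBelow C C' →
    ∀ {x y} → PivotEntry H C' x → PivotEntry H C' y → x < y → RowwiseBelow (swapVals x y C) C' →
    ¬ NonOverlapping H C'
  isHatColumn-overlaps {H = H} _ _ _ _ (q , pq , Hq) (q' , pq' , Hq') x<y _ (inj₁ one-pivot) =
    distinct-rows H Hq Hq' x<y (one-pivot q q' pq pq')
  isHatColumn-overlaps {S} {H} {C} col length-S C↭S below {x} {y} (q , pq , Hq) (q' , pq' , Hq') x<y below~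
    (inj₂ disjoint)
    with disjoint q q' x y pq pq' (distinct-rows H Hq Hq' x<y) Hq Hq'
  ... | inj₂ C'q'<x = pivot-¬LtB H C' pq' Hq' (LtB-mono (C' ‼ q') (<⇒≤ x<y) C'q'<x)
  ... | inj₁ C'q<y with d , C'q , d<y ← LtB⇒just (C' ‼ q) C'q<y =
    no-room-above (↭-trans C↭S (↭-sym H↭S)) length-C length-H
      (rowwiseBelow⇒rowAbove C below length-C) H-above (proj₂ row-of-x) (<⇒≤ x<d)
      (rowwiseBelow⇒rowAbove (swapVals x y C) below~ (trans (length-map _ C) length-C)
        (swapVals-‼ C (proj₂ row-of-x)) d<y)
    where
      open IsHatColumn col renaming (entries to H↭S)
      length-H = trans (↭-length H↭S) length-S
      length-C = trans (↭-length C↭S) length-S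

      x<d : x < d
      x<d = pivot-< H C' pq Hq C'q

      x∉C' : x ∉ C'
      x∉C' with placed Hq
      ... | inj₁ C'q≡x = ⊥-elim (<-irrefl (just-injective (trans (sym C'q≡x) C'q)) x<d)
      ... | inj₂ (x∉C' , _) = x∉C'

      H-above : ∀ {r} → RowAbove d r → ∃[ w ] (H ‼ r ≡ just w × d < w)
      H-above = rows-above-filled col length-H Hq x∉C' C'q λ {r} {w} pr q≢r Hᵣ →
        subst (λ m → DisjointIntervals x m w (C' ‼ r)) C'q (disjoint q r x w pq pr q≢r Hq Hᵣ)

      row-of-x : ∃[ rx ] (C ‼ rx ≡ just x)
      row-of-x = ∈⇒‼ C (∈-resp-↭ (↭-sym C↭S) (∈-resp-↭ H↭S (‼⇒∈ H q Hq)))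

hat-isHatColumn : ∀ C' S c≡ → Linked _<_ S → HatConstruction.HallCondition C' (length S) c≡ S →
  HatConstruction.IsHatColumn C' (length S) c≡ S (hat S C')
hat-isHatColumn C' S c≡ sorted hall =
  subst (IsHatColumn S) (sym hat≡catMaybes) (invariant⇒isHatColumn H complete)
  where
    open HatConstruction C' (length S) c≡
    I = hatState-invariant S sorted hall
    st = foldr (hatStep (length S) C') (replicate (length S) nothing) S
    H = catMaybes st

    st≡ : st ≡ map just H
    st≡ = catMaybes-complete st (trans (↭-length (HatInvariant.entries I)) (sym (HatInvariant.length≡ I)))

    complete : HatInvariant S (map just H)
    complete = subst (HatInvariant S) st≡ I

    hat≡catMaybes : hat S C' ≡ H
    hat≡catMaybes = trans (cong (map (fromMaybe 0)) st≡) (trans (sym (map-∘ H)) (map-id H))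

lemma4p1 : (C' S C : List ℕ) →
    Unique C' → All (0 <_) C' →
    Linked _<_ S → All (0 <_) S →
    (length S ≡ length C' ⊎ length S ≡ suc (length C')) →
    (∀ r s e → r < length C' → S ‼ r ≡ just s → sortℕ C' ‼ r ≡ just e → s ≤ e) →
    C ↭ S → HHL C C' →
    (x y : ℕ) → PivotEntry (hat S C') C' x → PivotEntry (hat S C') C' y → x < y →
    HHL (swapVals x y C) C' →
    ¬ NonOverlapping (hat S C') C'
lemma4p1 C' S C _ _ sorted _ c≡ bounded C↭S hhl x y px py x<y hhl~ =
  isHatColumn-overlaps (hat-isHatColumn C' S c≡ sorted (sorted-hall S refl bounded)) refl C↭S
    (HHL⇒RowwiseBelow hhl) px py x<y (HHL⇒RowwiseBelow hhl~)
  where open HatConstruction C' (length S) c≡
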